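{- Let $P$ be a connected finite poset with at least two points and let $C\subseteq E(P)$ be a 4-crown of $P$. Assume that $\mathcal{F}(P)$ is a clique of $\mathfrak{F}(P)$, i.e. $\mathcal{F}(P)\neq\emptyset$ and any two elements of $\mathcal{F}(P)$ share a point of $L(P)$ and share a point of $U(P)$. Then $C$ is a retract of $P$ if and only if there exists an edge of $C$ (a pair $x<_P y$ with $x,y\in C$) such that no $F\in\mathcal{F}(P)$ contains both $x$ and $y$.
   Context: All posets are finite; subsets are identified with induced subposets. $L(P)$, $U(P)$: minimal and maximal points of $P$; $E(P)=L(P)\cup U(P)$. $[x,y]_P=\{z: x\leq_P z\leq_P y\}$. A crown is a subset whose comparability graph (edges between distinct comparable elements) is a cycle; a 4-crown $D=\{a,b,v,w\}$ with $L(D)=\{a,b\}$, $U(D)=\{v,w\}$ is improper if $[a,v]_P\cap[b,w]_P\neq\emptyset$. $\mathcal{F}(P)$ is the set of improper 4-crowns of $P$ contained in $E(P)$, and $\mathfrak{F}(P)$ is the multigraph on $\mathcal{F}(P)$ with an L-edge between $F,G$ iff $L(P)\cap F\cap G\neq\emptyset$ and a U-edge iff $U(P)\cap F\cap G\neq\emptyset$; a clique is a nonempty set of vertices pairwise joined by both an L-edge and a U-edge. A retraction is an idempotent order homomorphism $r:P\to P$; its image is a retract. -}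

module Defs where

open import Level using (0ℓ)
open import Data.Nat using (ℕ)
open import Data.Fin using (Fin)
open import Data.Product using (Σ; ∃; _×_; _,_)
open import Data.Sum using (_⊎_)
open import Relation.Nullary using (¬_)
open import Relation.Binary.PropositionalEquality using (_≡_; _≢_)
open import Relation.Binary.Definitions using (Decidable)
open import Relation.Binary.Structures using (IsPartialOrder)

record FinPoset : Set₁ where
  field
    n    : ℕ
    _≤_  : Fin n → Fin n → Set
    isPartialOrder : IsPartialOrder _≡_ _≤_
    _≤?_ : Decidable _≤_

module _ (P : FinPoset) where
  open FinPoset P

  Pt : Set
  Pt = Fin n

  _<_ : Pt → Pt → Set
  x < y = (x ≤ y) × (x ≢ y)

  Comparable : Pt → Pt → Set
  Comparable x y = (x ≤ y) ⊎ (y ≤ x)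

  data Zigzag : Pt → Pt → Set where
    here : ∀ {x} → Zigzag x x
    step : ∀ {x y z} → Comparable x y → Zigzag y z → Zigzag x z

  Connected : Set
  Connected = ∀ x y → Zigzag x y

  -- L(P), U(P), E(P)
  IsMinimal : Pt → Set
  IsMinimal x = ∀ y → y ≤ x → y ≡ x

  IsMaximal : Pt → Set
  IsMaximal x = ∀ y → x ≤ y → y ≡ x

  InE : Pt → Set
  InE x = IsMinimal x ⊎ IsMaximal x

  record Crown4 : Set where
    field
      a b v w : Pt
      a<v : a < v
      a<w : a < w
      b<v : b < v
      b<w : b < w
      a∥b : ¬ Comparable a b
      v∥w : ¬ Comparable v w

  open Crown4 public

  _∈C_ : Pt → Crown4 → Set
  x ∈C D = (x ≡ a D) ⊎ (x ≡ b D) ⊎ (x ≡ v D) ⊎ (x ≡ w D)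

  CrownInE : Crown4 → Set
  CrownInE D = ∀ x → x ∈C D → InE x

  _∈[_,_] : Pt → Pt → Pt → Set
  z ∈[ x , y ] = (x ≤ z) × (z ≤ y)

  Improper : Crown4 → Set
  Improper D = ∃ λ z → (z ∈[ a D , v D ]) × (z ∈[ b D , w D ])

  InFP : Crown4 → Set
  InFP F = Improper F × CrownInE F

  FIsClique : Set
  FIsClique =
    (∃ λ F → InFP F) ×
    (∀ F G → InFP F → InFP G →
       (∃ λ x → IsMinimal x × x ∈C F × x ∈C G) ×
       (∃ λ x → IsMaximal x × x ∈C F × x ∈C G))

  IsRetraction : (Pt → Pt) → Set
  IsRetraction r = (∀ x y → x ≤ y → r x ≤ r y) × (∀ x → r (r x) ≡ r x)

  IsRetractOf : Crown4 → Set
  IsRetractOf C = ∃ λ (r : Pt → Pt) → IsRetraction r ×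
    (∀ x → r x ∈C C) × (∀ c → c ∈C C → ∃ λ x → r x ≡ c)

{-# OPTIONS --safe #-}
module Submission where

-- If some edge x < y of C lies in no member of 𝓕(P), write C = {x, x′ ; y, y′} and retract P
-- onto C: points not above x go to x′, points above x but not below y go to y′, and a point of
-- [x, y] goes to x if everything below it is above x, and to y otherwise.  This is monotone
-- because the points sent to y form an up-set: a point q above one of them but not below y would
-- give, together with a minimal point under a witness that is not above x and a maximal point
-- over q, a member of 𝓕(P) containing x and y.
-- Conversely, a retraction r onto C fixes C, so it maps a centre of a member of 𝓕(P) containing
-- an edge of C onto that edge.  Any two members of the clique share a minimal and a maximal point,
-- hence the images of their centres have a common lower and a common upper bound, and so are
-- never the two minimal or the two maximal points of C.  This rules out an image on each of the
-- four edges of C.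

open import Defs
open import Data.Nat using (_≤_)
open import Data.Product using (∃; Σ; _×_; _,_; proj₁; proj₂)
open import Data.Sum using (_⊎_; inj₁; inj₂; [_,_]′; map₂; swap)
open import Data.Empty using (⊥; ⊥-elim)
open import Data.Fin.Properties using (_≟_; any?; all?)
open import Data.Fin.Induction using (po-wellFounded)
open import Function using (flip; id; _∘_)
open import Function.Bundles using (_⇔_; mk⇔)
open import Induction.WellFounded using (module All)
open import Relation.Binary.PropositionalEquality
  using (_≡_; refl; sym; cong; subst; module ≡-Reasoning)
open import Relation.Binary.Structures using (IsPartialOrder)
open import Relation.Nullary using (¬_; Dec; yes; no)
open import Relation.Nullary.Decidable using (_×-dec_; _⊎-dec_; _→-dec_; ¬?; map′)
import Relation.Binary.Construct.Flip.EqAndOrd as Flip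

dual : FinPoset → FinPoset
dual P = record
  { n = n
  ; _≤_ = flip _⊑_
  ; isPartialOrder = Flip.isPartialOrder isPartialOrder
  ; _≤?_ = flip _⊑?_
  }
  where open FinPoset P renaming (_≤_ to _⊑_; _≤?_ to _⊑?_)

module Extremal (P : FinPoset) where
  open FinPoset P renaming (_≤_ to _⊑_; _≤?_ to _⊑?_)
  open IsPartialOrder isPartialOrder using () renaming (refl to ⊑-refl; trans to ⊑-trans)

  minimal-below : ∀ x → ∃ λ m → IsMinimal P m × m ⊑ x
  minimal-below = All.wfRec (po-wellFounded isPartialOrder) _ _ descend
    where
    descend : ∀ x → (∀ {y} → _<_ P y x → ∃ λ m → IsMinimal P m × m ⊑ y) →
              ∃ λ m → IsMinimal P m × m ⊑ x
    descend x below with any? (λ y → (y ⊑? x) ×-dec ¬? (y ≟ x))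
    ... | yes (y , y<x) =
      let (m , m-min , m⊑y) = below y<x in m , m-min , ⊑-trans m⊑y (proj₁ y<x)
    ... | no ¬∃y<x = x , x-min , ⊑-refl
      where
      x-min : IsMinimal P x
      x-min y y⊑x with y ≟ x
      ... | yes y≡x = y≡x
      ... | no y≢x = ⊥-elim (¬∃y<x (y , y⊑x , y≢x))

module _ (P : FinPoset) where
  open FinPoset P renaming (_≤_ to _⊑_; _≤?_ to _⊑?_)
  open IsPartialOrder isPartialOrder using () renaming (refl to ⊑-refl; trans to ⊑-trans)
  open Extremal P using (minimal-below)

  private
    _⊏_ : Pt P → Pt P → Set
    _⊏_ = _<_ P

    _∈_ : Pt P → Crown4 P → Set
    _∈_ = _∈C_ P

  maximal-above : ∀ x → ∃ λ M → IsMaximal P M × x ⊑ M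
  maximal-above = Extremal.minimal-below (dual P)

  minimal? : ∀ x → Dec (IsMinimal P x)
  minimal? x = all? (λ y → (y ⊑? x) →-dec (y ≟ x))

  maximal? : ∀ x → Dec (IsMaximal P x)
  maximal? x = all? (λ y → (x ⊑? y) →-dec (y ≟ x))

  <⇒¬maximal : ∀ {x y} → x ⊏ y → ¬ IsMaximal P x
  <⇒¬maximal (x⊑y , x≢y) x-max = x≢y (sym (x-max _ x⊑y))

  <⇒¬minimal : ∀ {x y} → x ⊏ y → ¬ IsMinimal P y
  <⇒¬minimal (x⊑y , x≢y) y-min = x≢y (y-min _ x⊑y)

  InE∧<⇒minimal : ∀ {x y} → InE P x → x ⊏ y → IsMinimal P x
  InE∧<⇒minimal (inj₁ x-min) _ = x-min
  InE∧<⇒minimal (inj₂ x-max) x<y = ⊥-elim (<⇒¬maximal x<y x-max)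

  InE∧>⇒maximal : ∀ {x y} → InE P y → x ⊏ y → IsMaximal P y
  InE∧>⇒maximal (inj₁ y-min) x<y = ⊥-elim (<⇒¬minimal x<y y-min)
  InE∧>⇒maximal (inj₂ y-max) _ = y-max

  InE-squeeze : ∀ {l c u} → InE P c → l ⊑ c → c ⊑ u → l ≡ c ⊎ u ≡ c
  InE-squeeze (inj₁ c-min) l⊑c _ = inj₁ (c-min _ l⊑c)
  InE-squeeze (inj₂ c-max) _ c⊑u = inj₂ (c-max _ c⊑u)

  ≤∧≱⇒< : ∀ {x y} → x ⊑ y → ¬ y ⊑ x → x ⊏ y
  ≤∧≱⇒< x⊑y y⋢x = x⊑y , λ { refl → y⋢x x⊑y }

  Monotone : (Pt P → Pt P) → Set
  Monotone r = ∀ x y → x ⊑ y → r x ⊑ r y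

  retraction-fixes-image : ∀ {r z c} → IsRetraction P r → r z ≡ c → r c ≡ c
  retraction-fixes-image {r} {z} {c} (_ , r-idem) rz≡c = begin
    r c      ≡⟨ cong r (sym rz≡c) ⟩
    r (r z)  ≡⟨ r-idem z ⟩
    r z      ≡⟨ rz≡c ⟩
    c        ∎
    where open ≡-Reasoning

  Compatible : Pt P → Pt P → Set
  Compatible c d = (∃ λ l → l ⊑ c × l ⊑ d) × (∃ λ u → c ⊑ u × d ⊑ u)

  minimal∧incomparable⇒¬compatible : ∀ {x y} → IsMinimal P x → ¬ Comparable P x y →
                                     ¬ Compatible x y
  minimal∧incomparable⇒¬compatible x-min x∦y ((l , l⊑x , l⊑y) , _) =
    x∦y (inj₁ (subst (_⊑ _) (x-min l l⊑x) l⊑y))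

  maximal∧incomparable⇒¬compatible : ∀ {x y} → IsMaximal P x → ¬ Comparable P x y →
                                     ¬ Compatible x y
  maximal∧incomparable⇒¬compatible x-max x∦y (_ , (u , x⊑u , y⊑u)) =
    x∦y (inj₂ (subst (_ ⊑_) (x-max u x⊑u) y⊑u))

  compatible-map : ∀ {r c d} → Monotone r → Compatible c d → Compatible (r c) (r d)
  compatible-map {r} {c} {d} r-mono ((l , l⊑c , l⊑d) , (u , c⊑u , d⊑u)) =
    (r l , r-mono l c l⊑c , r-mono l d l⊑d) , (r u , r-mono c u c⊑u , r-mono d u d⊑u)

  a∈ : ∀ D → a D ∈ D
  a∈ D = inj₁ refl

  b∈ : ∀ D → b D ∈ D
  b∈ D = inj₂ (inj₁ refl)

  v∈ : ∀ D → v D ∈ D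
  v∈ D = inj₂ (inj₂ (inj₁ refl))

  w∈ : ∀ D → w D ∈ D
  w∈ D = inj₂ (inj₂ (inj₂ refl))

  IsCentre : Crown4 P → Pt P → Set
  IsCentre F z = _∈[_,_] P z (a F) (v F) × _∈[_,_] P z (b F) (w F)

  centre-above-minimal : ∀ {F z m} → IsCentre F z → IsMinimal P m → m ∈ F → m ⊑ z
  centre-above-minimal ((a⊑z , _) , _) _ (inj₁ refl) = a⊑z
  centre-above-minimal (_ , (b⊑z , _)) _ (inj₂ (inj₁ refl)) = b⊑z
  centre-above-minimal {F} _ v-min (inj₂ (inj₂ (inj₁ refl))) = ⊥-elim (<⇒¬minimal (a<v F) v-min)
  centre-above-minimal {F} _ w-min (inj₂ (inj₂ (inj₂ refl))) = ⊥-elim (<⇒¬minimal (a<w F) w-min)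

  centre-below-maximal : ∀ {F z M} → IsCentre F z → IsMaximal P M → M ∈ F → z ⊑ M
  centre-below-maximal {F} _ a-max (inj₁ refl) = ⊥-elim (<⇒¬maximal (a<v F) a-max)
  centre-below-maximal {F} _ b-max (inj₂ (inj₁ refl)) = ⊥-elim (<⇒¬maximal (b<v F) b-max)
  centre-below-maximal ((_ , z⊑v) , _) _ (inj₂ (inj₂ (inj₁ refl))) = z⊑v
  centre-below-maximal (_ , (_ , z⊑w)) _ (inj₂ (inj₂ (inj₂ refl))) = z⊑w

  Centre : Pt P → Set
  Centre z = ∃ λ F → InFP P F × IsCentre F z

  centres-compatible : FIsClique P → ∀ {z z′} → Centre z → Centre z′ → Compatible z z′
  centres-compatible (_ , share) {z} {z′} (F , F∈𝓕 , centre) (G , G∈𝓕 , centre′)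
    with share F G F∈𝓕 G∈𝓕
  ... | (m , m-min , m∈F , m∈G) , (M , M-max , M∈F , M∈G) =
    (m , centre-above-minimal {F} {z} centre m-min m∈F ,
         centre-above-minimal {G} {z′} centre′ m-min m∈G) ,
    (M , centre-below-maximal {F} {z} centre M-max M∈F ,
         centre-below-maximal {G} {z′} centre′ M-max M∈G)

  Covered : Pt P → Pt P → Set
  Covered x y = ∃ λ F → InFP P F × x ∈ F × y ∈ F

  Uncovered : Pt P → Pt P → Set
  Uncovered x y = ∀ F → InFP P F → ¬ (x ∈ F × y ∈ F)

  ¬covered⇒uncovered : ∀ {x y} → ¬ Covered x y → Uncovered x y
  ¬covered⇒uncovered ¬covered F F∈𝓕 (x∈F , y∈F) = ¬covered (F , F∈𝓕 , x∈F , y∈F)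

  IsCrown : Pt P → Pt P → Pt P → Pt P → Set
  IsCrown x₁ x₂ y₁ y₂ = x₁ ⊏ y₁ × x₁ ⊏ y₂ × x₂ ⊏ y₁ × x₂ ⊏ y₂ ×
                        ¬ Comparable P x₁ x₂ × ¬ Comparable P y₁ y₂

  crown : ∀ {x₁ x₂ y₁ y₂} → IsCrown x₁ x₂ y₁ y₂ → Crown4 P
  crown {x₁} {x₂} {y₁} {y₂} (x₁<y₁ , x₁<y₂ , x₂<y₁ , x₂<y₂ , x₁∦x₂ , y₁∦y₂) = record
    { a = x₁ ; b = x₂ ; v = y₁ ; w = y₂
    ; a<v = x₁<y₁ ; a<w = x₁<y₂ ; b<v = x₂<y₁ ; b<w = x₂<y₂
    ; a∥b = x₁∦x₂ ; v∥w = y₁∦y₂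
    }

  crown⁻¹ : (F : Crown4 P) → IsCrown (a F) (b F) (v F) (w F)
  crown⁻¹ F = a<v F , a<w F , b<v F , b<w F , a∥b F , v∥w F

  isCrown? : ∀ x₁ x₂ y₁ y₂ → Dec (IsCrown x₁ x₂ y₁ y₂)
  isCrown? x₁ x₂ y₁ y₂ = x₁ <? y₁ ×-dec x₁ <? y₂ ×-dec x₂ <? y₁ ×-dec x₂ <? y₂ ×-dec
                         ¬? (comparable? x₁ x₂) ×-dec ¬? (comparable? y₁ y₂)
    where
    _<?_ : ∀ x y → Dec (x ⊏ y)
    x <? y = (x ⊑? y) ×-dec ¬? (x ≟ y)
    comparable? : ∀ x y → Dec (Comparable P x y)
    comparable? x y = (x ⊑? y) ⊎-dec (y ⊑? x)

  _∈?_ : ∀ c F → Dec (c ∈ F)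
  c ∈? F = (c ≟ a F) ⊎-dec (c ≟ b F) ⊎-dec (c ≟ v F) ⊎-dec (c ≟ w F)

  InFP? : ∀ F → Dec (InFP P F)
  InFP? F = improper? ×-dec crownInE?
    where
    improper? : Dec (Improper P F)
    improper? = any? λ z →
      ((a F ⊑? z) ×-dec (z ⊑? v F)) ×-dec ((b F ⊑? z) ×-dec (z ⊑? w F))
    InE? : ∀ x → Dec (InE P x)
    InE? x = minimal? x ⊎-dec maximal? x
    crownInE? : Dec (CrownInE P F)
    crownInE? = map′
      (λ (a∈E , b∈E , v∈E , w∈E) → λ
        { _ (inj₁ refl) → a∈E
        ; _ (inj₂ (inj₁ refl)) → b∈E
        ; _ (inj₂ (inj₂ (inj₁ refl))) → v∈E
        ; _ (inj₂ (inj₂ (inj₂ refl))) → w∈E })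
      (λ F⊆E → F⊆E _ (a∈ F) , F⊆E _ (b∈ F) , F⊆E _ (v∈ F) , F⊆E _ (w∈ F))
      (InE? (a F) ×-dec InE? (b F) ×-dec InE? (v F) ×-dec InE? (w F))

  -- Crowns are searched through their points.  Whether a crown lies in 𝓕(P) and contains x and y
  -- depends only on its points, so any proof of IsCrown for them will do.
  covered? : ∀ x y → Dec (Covered x y)
  covered? x y = map′
    (λ (_ , _ , _ , _ , k , covers) → crown k , covers)
    (λ (F , covers) → a F , b F , v F , w F , crown⁻¹ F , covers)
    (any? λ x₁ → any? λ x₂ → any? λ y₁ → any? λ y₂ → coveredBy? x₁ x₂ y₁ y₂)
    where
    Covers : Crown4 P → Set
    Covers F = InFP P F × x ∈ F × y ∈ F
    coveredBy? : ∀ x₁ x₂ y₁ y₂ → Dec (Σ (IsCrown x₁ x₂ y₁ y₂) (Covers ∘ crown))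
    coveredBy? x₁ x₂ y₁ y₂ with isCrown? x₁ x₂ y₁ y₂
    ... | no ¬k = no (¬k ∘ proj₁)
    ... | yes k with InFP? (crown k) ×-dec x ∈? crown k ×-dec y ∈? crown k
    ...   | yes covers = yes (k , covers)
    ...   | no ¬covers = no λ (_ , covers) → ¬covers covers

  _⊆_ : Crown4 P → Crown4 P → Set
  D ⊆ E = ∀ c → c ∈ D → c ∈ E

  ⊆-trans : ∀ D E F → D ⊆ E → E ⊆ F → D ⊆ F
  ⊆-trans _ _ _ D⊆E E⊆F c = E⊆F c ∘ D⊆E c

  swapLower : Crown4 P → Crown4 P
  swapLower D = record
    { a = b D ; b = a D ; v = v D ; w = w D
    ; a<v = b<v D ; a<w = b<w D ; b<v = a<v D ; b<w = a<w D
    ; a∥b = a∥b D ∘ swap ; v∥w = v∥w D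
    }

  swapUpper : Crown4 P → Crown4 P
  swapUpper D = record
    { a = a D ; b = b D ; v = w D ; w = v D
    ; a<v = a<w D ; a<w = a<v D ; b<v = b<w D ; b<w = b<v D
    ; a∥b = a∥b D ; v∥w = v∥w D ∘ swap
    }

  -- Both swaps are involutions on the points, so each inclusion below also gives the reverse one.
  swapLower-⊆ : ∀ D → swapLower D ⊆ D
  swapLower-⊆ D _ = [ inj₂ ∘ inj₁ , [ inj₁ , inj₂ ∘ inj₂ ]′ ]′

  swapUpper-⊆ : ∀ D → swapUpper D ⊆ D
  swapUpper-⊆ D _ = map₂ (map₂ swap)

  retract-transfer : ∀ {D C} → D ⊆ C → C ⊆ D → IsRetractOf P D → IsRetractOf P C
  retract-transfer D⊆C C⊆D (r , r-retraction , r-into , r-onto) =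
    r , r-retraction , (λ z → D⊆C _ (r-into z)) , (λ c c∈C → r-onto c (C⊆D c c∈C))

  module _ (C : Crown4 P) (C⊆E : CrownInE P C) where

    edge-source : ∀ {x y} → x ∈ C → x ⊏ y → x ≡ a C ⊎ x ≡ b C
    edge-source (inj₁ x≡a) _ = inj₁ x≡a
    edge-source (inj₂ (inj₁ x≡b)) _ = inj₂ x≡b
    edge-source x∈C@(inj₂ (inj₂ (inj₁ refl))) x<y =
      ⊥-elim (<⇒¬minimal (a<v C) (InE∧<⇒minimal (C⊆E _ x∈C) x<y))
    edge-source x∈C@(inj₂ (inj₂ (inj₂ refl))) x<y =
      ⊥-elim (<⇒¬minimal (a<w C) (InE∧<⇒minimal (C⊆E _ x∈C) x<y))

    edge-target : ∀ {x y} → y ∈ C → x ⊏ y → y ≡ v C ⊎ y ≡ w C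
    edge-target y∈C@(inj₁ refl) x<y =
      ⊥-elim (<⇒¬maximal (a<v C) (InE∧>⇒maximal (C⊆E _ y∈C) x<y))
    edge-target y∈C@(inj₂ (inj₁ refl)) x<y =
      ⊥-elim (<⇒¬maximal (b<v C) (InE∧>⇒maximal (C⊆E _ y∈C) x<y))
    edge-target (inj₂ (inj₂ (inj₁ y≡v))) _ = inj₁ y≡v
    edge-target (inj₂ (inj₂ (inj₂ y≡w))) _ = inj₂ y≡w

    orient-edge : ∀ {x y} → x ∈ C → y ∈ C → x ⊏ y →
                  ∃ λ D → a D ≡ x × v D ≡ y × D ⊆ C × C ⊆ D
    orient-edge x∈C y∈C x<y with edge-source x∈C x<y | edge-target y∈C x<y
    ... | inj₁ refl | inj₁ refl = C , refl , refl , (λ _ → id) , (λ _ → id)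
    ... | inj₁ refl | inj₂ refl =
      swapUpper C , refl , refl , swapUpper-⊆ C , swapUpper-⊆ (swapUpper C)
    ... | inj₂ refl | inj₁ refl =
      swapLower C , refl , refl , swapLower-⊆ C , swapLower-⊆ (swapLower C)
    ... | inj₂ refl | inj₂ refl =
      D , refl , refl ,
      ⊆-trans D (swapUpper C) C (swapLower-⊆ (swapUpper C)) (swapUpper-⊆ C) ,
      ⊆-trans C (swapUpper C) D (swapUpper-⊆ (swapUpper C)) (swapLower-⊆ (swapLower (swapUpper C)))
      where
      D : Crown4 P
      D = swapLower (swapUpper C)

  module RetractionOnto (D : Crown4 P) (x-min : IsMinimal P (a D)) (y-max : IsMaximal P (v D))
                        (x-y-uncovered : Uncovered (a D) (v D)) where

    private
      x x′ y y′ : Pt P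
      x = a D
      x′ = b D
      y = v D
      y′ = w D

      x⊑y : x ⊑ y
      x⊑y = proj₁ (a<v D)

    Escapes : Pt P → Set
    Escapes z = ∃ λ u → u ⊑ z × ¬ x ⊑ u

    Mixed : Pt P → Set
    Mixed z = x ⊑ z × z ⊑ y × Escapes z

    -- If q ⋢ y, a minimal m below the escaping point and a maximal M above q give the member
    -- {x, m ; y, M} of 𝓕(P) with centre p, which contains the edge x < y.
    mixed-upClosed : ∀ {p q} → Mixed p → p ⊑ q → Mixed q
    mixed-upClosed {p} {q} (x⊑p , p⊑y , u , u⊑p , x⋢u) p⊑q with q ⊑? y
    ... | yes q⊑y = ⊑-trans x⊑p p⊑q , q⊑y , u , ⊑-trans u⊑p p⊑q , x⋢u
    ... | no q⋢y with minimal-below u | maximal-above q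
    ...   | m , m-min , m⊑u | M , M-max , q⊑M =
      ⊥-elim (x-y-uncovered F (F-improper , F⊆E) (a∈ F , v∈ F))
      where
      m⊑p : m ⊑ p
      m⊑p = ⊑-trans m⊑u u⊑p
      p⊑M : p ⊑ M
      p⊑M = ⊑-trans p⊑q q⊑M
      m⊑y : m ⊑ y
      m⊑y = ⊑-trans m⊑p p⊑y
      F : Crown4 P
      F = record
        { a = x ; b = m ; v = y ; w = M
        ; a<v = a<v D
        ; a<w = ≤∧≱⇒< (⊑-trans x⊑p p⊑M) λ M⊑x → q⋢y (⊑-trans (⊑-trans q⊑M M⊑x) x⊑y)
        ; b<v = ≤∧≱⇒< m⊑y λ y⊑m → x⋢u (⊑-trans (⊑-trans x⊑y y⊑m) m⊑u)
        ; b<w = ≤∧≱⇒< (⊑-trans m⊑p p⊑M) λ M⊑m → q⋢y (⊑-trans (⊑-trans q⊑M M⊑m) m⊑y)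
        ; a∥b = λ { (inj₁ x⊑m) → x⋢u (⊑-trans x⊑m m⊑u)
                  ; (inj₂ m⊑x) → x⋢u (subst (_⊑ u) (x-min m m⊑x) m⊑u) }
        ; v∥w = λ { (inj₁ y⊑M) → q⋢y (subst (q ⊑_) (y-max M y⊑M) q⊑M)
                  ; (inj₂ M⊑y) → q⋢y (⊑-trans q⊑M M⊑y) }
        }
      F-improper : Improper P F
      F-improper = p , (x⊑p , p⊑y) , (m⊑p , p⊑M)
      F⊆E : CrownInE P F
      F⊆E _ (inj₁ refl) = inj₁ x-min
      F⊆E _ (inj₂ (inj₁ refl)) = inj₁ m-min
      F⊆E _ (inj₂ (inj₂ (inj₁ refl))) = inj₂ y-max
      F⊆E _ (inj₂ (inj₂ (inj₂ refl))) = inj₂ M-max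

    data Zone (z : Pt P) : Pt P → Set where
      off-↑x : ¬ x ⊑ z → Zone z x′
      off-↓y : x ⊑ z → ¬ z ⊑ y → Zone z y′
      pure   : x ⊑ z → z ⊑ y → ¬ Escapes z → Zone z x
      mixed  : Mixed z → Zone z y

    zone : ∀ z → ∃ (Zone z)
    zone z with x ⊑? z
    ... | no x⋢z = x′ , off-↑x x⋢z
    ... | yes x⊑z with z ⊑? y
    ...   | no z⋢y = y′ , off-↓y x⊑z z⋢y
    ...   | yes z⊑y with any? (λ u → (u ⊑? z) ×-dec ¬? (x ⊑? u))
    ...     | yes escape = y , mixed (x⊑z , z⊑y , escape)
    ...     | no ¬escape = x , pure x⊑z z⊑y ¬escape

    r : Pt P → Pt P
    r = proj₁ ∘ zone

    zone-unique : ∀ {z s t} → Zone z s → Zone z t → s ≡ t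
    zone-unique (off-↑x _) (off-↑x _) = refl
    zone-unique (off-↑x x⋢z) (off-↓y x⊑z _) = ⊥-elim (x⋢z x⊑z)
    zone-unique (off-↑x x⋢z) (pure x⊑z _ _) = ⊥-elim (x⋢z x⊑z)
    zone-unique (off-↑x x⋢z) (mixed (x⊑z , _)) = ⊥-elim (x⋢z x⊑z)
    zone-unique (off-↓y x⊑z _) (off-↑x x⋢z) = ⊥-elim (x⋢z x⊑z)
    zone-unique (off-↓y _ _) (off-↓y _ _) = refl
    zone-unique (off-↓y _ z⋢y) (pure _ z⊑y _) = ⊥-elim (z⋢y z⊑y)
    zone-unique (off-↓y _ z⋢y) (mixed (_ , z⊑y , _)) = ⊥-elim (z⋢y z⊑y)
    zone-unique (pure x⊑z _ _) (off-↑x x⋢z) = ⊥-elim (x⋢z x⊑z)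
    zone-unique (pure _ z⊑y _) (off-↓y _ z⋢y) = ⊥-elim (z⋢y z⊑y)
    zone-unique (pure _ _ _) (pure _ _ _) = refl
    zone-unique (pure _ _ ¬escape) (mixed (_ , _ , escape)) = ⊥-elim (¬escape escape)
    zone-unique (mixed (x⊑z , _)) (off-↑x x⋢z) = ⊥-elim (x⋢z x⊑z)
    zone-unique (mixed (_ , z⊑y , _)) (off-↓y _ z⋢y) = ⊥-elim (z⋢y z⊑y)
    zone-unique (mixed (_ , _ , escape)) (pure _ _ ¬escape) = ⊥-elim (¬escape escape)
    zone-unique (mixed _) (mixed _) = refl

    zone-monotone : ∀ {p q s t} → p ⊑ q → Zone p s → Zone q t → s ⊑ t
    zone-monotone _ (off-↑x _) (off-↑x _) = ⊑-refl
    zone-monotone _ (off-↑x _) (off-↓y _ _) = proj₁ (b<w D)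
    zone-monotone p⊑q (off-↑x x⋢p) (pure _ _ ¬escape) = ⊥-elim (¬escape (_ , p⊑q , x⋢p))
    zone-monotone _ (off-↑x _) (mixed _) = proj₁ (b<v D)
    zone-monotone p⊑q (off-↓y x⊑p _) (off-↑x x⋢q) = ⊥-elim (x⋢q (⊑-trans x⊑p p⊑q))
    zone-monotone _ (off-↓y _ _) (off-↓y _ _) = ⊑-refl
    zone-monotone p⊑q (off-↓y _ p⋢y) (pure _ q⊑y _) = ⊥-elim (p⋢y (⊑-trans p⊑q q⊑y))
    zone-monotone p⊑q (off-↓y _ p⋢y) (mixed (_ , q⊑y , _)) = ⊥-elim (p⋢y (⊑-trans p⊑q q⊑y))
    zone-monotone p⊑q (pure x⊑p _ _) (off-↑x x⋢q) = ⊥-elim (x⋢q (⊑-trans x⊑p p⊑q))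
    zone-monotone _ (pure _ _ _) (off-↓y _ _) = proj₁ (a<w D)
    zone-monotone _ (pure _ _ _) (pure _ _ _) = ⊑-refl
    zone-monotone _ (pure _ _ _) (mixed _) = x⊑y
    zone-monotone p⊑q (mixed (x⊑p , _)) (off-↑x x⋢q) = ⊥-elim (x⋢q (⊑-trans x⊑p p⊑q))
    zone-monotone p⊑q (mixed p-mixed) (off-↓y _ q⋢y) =
      ⊥-elim (q⋢y (proj₁ (proj₂ (mixed-upClosed p-mixed p⊑q))))
    zone-monotone p⊑q (mixed (_ , _ , u , u⊑p , x⋢u)) (pure _ _ ¬escape) =
      ⊥-elim (¬escape (u , ⊑-trans u⊑p p⊑q , x⋢u))
    zone-monotone _ (mixed _) (mixed _) = ⊑-refl

    zone-into : ∀ {z t} → Zone z t → t ∈ D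
    zone-into (off-↑x _) = b∈ D
    zone-into (off-↓y _ _) = w∈ D
    zone-into (pure _ _ _) = a∈ D
    zone-into (mixed _) = v∈ D

    zone-of-crown : ∀ {c} → c ∈ D → Zone c c
    zone-of-crown (inj₁ refl) = pure ⊑-refl x⊑y λ (u , u⊑x , x⋢u) →
      x⋢u (subst (x ⊑_) (sym (x-min u u⊑x)) ⊑-refl)
    zone-of-crown (inj₂ (inj₁ refl)) = off-↑x (a∥b D ∘ inj₁)
    zone-of-crown (inj₂ (inj₂ (inj₁ refl))) =
      mixed (x⊑y , ⊑-refl , x′ , proj₁ (b<v D) , a∥b D ∘ inj₁)
    zone-of-crown (inj₂ (inj₂ (inj₂ refl))) = off-↓y (proj₁ (a<w D)) (v∥w D ∘ inj₂)

    r-fixes : ∀ {c} → c ∈ D → r c ≡ c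
    r-fixes c∈D = zone-unique (proj₂ (zone _)) (zone-of-crown c∈D)

    retraction : IsRetractOf P D
    retraction = r , (r-monotone , r-idempotent) , r-into , λ c c∈D → c , r-fixes c∈D
      where
      r-into : ∀ z → r z ∈ D
      r-into z = zone-into (proj₂ (zone z))
      r-monotone : Monotone r
      r-monotone p q p⊑q = zone-monotone p⊑q (proj₂ (zone p)) (proj₂ (zone q))
      r-idempotent : ∀ z → r (r z) ≡ r z
      r-idempotent z = r-fixes (r-into z)

  uncovered-edge⇒retract : ∀ C → CrownInE P C → ∀ {x y} → x ∈ C → y ∈ C → x ⊏ y →
                           Uncovered x y → IsRetractOf P C
  uncovered-edge⇒retract C C⊆E x∈C y∈C x<y x-y-uncovered
    with orient-edge C C⊆E x∈C y∈C x<y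
  ... | D , refl , refl , D⊆C , C⊆D =
    retract-transfer {D} {C} D⊆C C⊆D (RetractionOnto.retraction D
      (InE∧<⇒minimal (C⊆E _ x∈C) x<y) (InE∧>⇒maximal (C⊆E _ y∈C) x<y) x-y-uncovered)

  Hits : (Pt P → Set) → Pt P → Pt P → Set
  Hits S x y = ∃ λ c → S c × (x ≡ c ⊎ y ≡ c)

  ¬compatible-transversal : (C : Crown4 P) → IsMinimal P (a C) → IsMaximal P (v C) →
    (S : Pt P → Set) → (∀ {c d} → S c → S d → Compatible c d) →
    Hits S (a C) (v C) → Hits S (b C) (w C) → Hits S (a C) (w C) → Hits S (b C) (v C) → ⊥
  ¬compatible-transversal C a-min v-max S compatible = transversal
    where
    ¬ab : ¬ Compatible (a C) (b C)
    ¬ab = minimal∧incomparable⇒¬compatible a-min (a∥b C)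
    ¬vw : ¬ Compatible (v C) (w C)
    ¬vw = maximal∧incomparable⇒¬compatible v-max (v∥w C)
    transversal : Hits S (a C) (v C) → Hits S (b C) (w C) → Hits S (a C) (w C) →
                  Hits S (b C) (v C) → ⊥
    transversal (_ , s₁ , inj₁ refl) (_ , s₂ , inj₁ refl) _ _ = ¬ab (compatible s₁ s₂)
    transversal (_ , s₁ , inj₂ refl) (_ , s₂ , inj₂ refl) _ _ = ¬vw (compatible s₁ s₂)
    transversal (_ , s₁ , inj₁ refl) (_ , _ , inj₂ refl) _ (_ , s₄ , inj₁ refl) =
      ¬ab (compatible s₁ s₄)
    transversal (_ , _ , inj₁ refl) (_ , s₂ , inj₂ refl) _ (_ , s₄ , inj₂ refl) =
      ¬vw (compatible s₄ s₂)
    transversal (_ , _ , inj₂ refl) (_ , s₂ , inj₁ refl) (_ , s₃ , inj₁ refl) _ =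
      ¬ab (compatible s₃ s₂)
    transversal (_ , s₁ , inj₂ refl) (_ , _ , inj₁ refl) (_ , s₃ , inj₂ refl) _ =
      ¬vw (compatible s₁ s₃)

  retract⇒uncovered-edge : ∀ C → CrownInE P C → FIsClique P → IsRetractOf P C →
                           ∃ λ x → ∃ λ y → x ∈ C × y ∈ C × x ⊏ y × Uncovered x y
  retract⇒uncovered-edge C C⊆E clique (r , r-retraction , r-into , r-onto)
    with covered? (a C) (v C) | covered? (b C) (w C) | covered? (a C) (w C) | covered? (b C) (v C)
  ... | no ¬av | _ | _ | _ = a C , v C , a∈ C , v∈ C , a<v C , ¬covered⇒uncovered ¬av
  ... | yes _ | no ¬bw | _ | _ = b C , w C , b∈ C , w∈ C , b<w C , ¬covered⇒uncovered ¬bw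
  ... | yes _ | yes _ | no ¬aw | _ = a C , w C , a∈ C , w∈ C , a<w C , ¬covered⇒uncovered ¬aw
  ... | yes _ | yes _ | yes _ | no ¬bv = b C , v C , b∈ C , v∈ C , b<v C , ¬covered⇒uncovered ¬bv
  ... | yes av | yes bw | yes aw | yes bv = ⊥-elim
    (¬compatible-transversal C (edge-minimal (a∈ C) (a<v C)) (edge-maximal (v∈ C) (a<v C))
      CentreImage centre-images-compatible
      (hit (a∈ C) (v∈ C) (a<v C) av) (hit (b∈ C) (w∈ C) (b<w C) bw)
      (hit (a∈ C) (w∈ C) (a<w C) aw) (hit (b∈ C) (v∈ C) (b<v C) bv))
    where
    r-mono : Monotone r
    r-mono = proj₁ r-retraction

    edge-minimal : ∀ {x y} → x ∈ C → x ⊏ y → IsMinimal P x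
    edge-minimal x∈C = InE∧<⇒minimal (C⊆E _ x∈C)

    edge-maximal : ∀ {x y} → y ∈ C → x ⊏ y → IsMaximal P y
    edge-maximal y∈C = InE∧>⇒maximal (C⊆E _ y∈C)

    r-fixes : ∀ {c} → c ∈ C → r c ≡ c
    r-fixes c∈C = retraction-fixes-image r-retraction (proj₂ (r-onto _ c∈C))

    CentreImage : Pt P → Set
    CentreImage c = ∃ λ z → Centre z × r z ≡ c

    centre-images-compatible : ∀ {c d} → CentreImage c → CentreImage d → Compatible c d
    centre-images-compatible (_ , z-centre , refl) (_ , z′-centre , refl) =
      compatible-map r-mono (centres-compatible clique z-centre z′-centre)

    hit : ∀ {x y} → x ∈ C → y ∈ C → x ⊏ y → Covered x y → Hits CentreImage x y
    hit {x} {y} x∈C y∈C x<y (F , F∈𝓕@((z , z-centre) , _) , x∈F , y∈F) =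
      r z , (z , (F , F∈𝓕 , z-centre) , refl) , InE-squeeze (C⊆E _ (r-into z)) x⊑rz rz⊑y
      where
      x⊑rz : x ⊑ r z
      x⊑rz = subst (_⊑ r z) (r-fixes x∈C)
        (r-mono _ _ (centre-above-minimal {F} z-centre (edge-minimal x∈C x<y) x∈F))
      rz⊑y : r z ⊑ y
      rz⊑y = subst (r z ⊑_) (r-fixes y∈C)
        (r-mono _ _ (centre-below-maximal {F} z-centre (edge-maximal y∈C x<y) y∈F))

corollary2 : (P : FinPoset) → Connected P → 2 ≤ FinPoset.n P →
    (C : Crown4 P) → CrownInE P C → FIsClique P →
    (IsRetractOf P C ⇔
      (∃ λ x → ∃ λ y → _∈C_ P x C × _∈C_ P y C × _<_ P x y ×
        (∀ F → InFP P F → ¬ (_∈C_ P x F × _∈C_ P y F))))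
corollary2 P _ _ C C⊆E clique = mk⇔
  (retract⇒uncovered-edge P C C⊆E clique)
  (λ (_ , _ , x∈C , y∈C , x<y , x-y-uncovered) →
     uncovered-edge⇒retract P C C⊆E x∈C y∈C x<y x-y-uncovered)
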